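{- For any composition $\alpha$ of $n$, the set $A_{\alpha,\alpha}$ contains exactly one pair $(S,T)$, and for this pair $\operatorname{perm}(T)$ is the identity permutation.
   Context: A composition of $n$ is a finite sequence of positive integers summing to $n$; a weak composition is a sequence of nonnegative integers. For a composition $\alpha=(\alpha_1,\dots,\alpha_\ell)$, its diagram is the set of cells $(i,j)$ with $1\le i\le\ell$, $1\le j\le\alpha_i$ (row $i$ from the top, column $j$ from the left). An immaculate tableau of shape $\alpha$ is a map $S$ from the cells of $\alpha$ to positive integers such that each row is weakly increasing from left to right ($S(i,j)\le S(i,j+1)$) and the first column is strictly increasing from top to bottom ($S(i,1)<S(i+1,1)$). Its content is the weak composition whose $k$-th entry is the number of cells with entry $k$. For an integer sequence $a$, $\operatorname{fl}(a)$ deletes the zero entries. Tunnel hook coverings (THCs) are combinatorial objects introduced by Allen and Mason; only these facts are needed: for a composition $\beta=(\beta_1,\dots,\beta_\ell)$, each THC $T$ of shape $\beta$ has a permutation $\operatorname{perm}(T)\in S_\ell$, and $T\mapsto\operatorname{perm}(T)$ is a bijection from THCs of shape $\beta$ onto $S_\ell$; $\Delta(T)=(\Delta_1(T),\dots,\Delta_\ell(T))$ with $\Delta_i(T)=\beta_i+\sigma_i-i$ for $\sigma=\operatorname{perm}(T)$; the content of $T$ is $\operatorname{fl}(\Delta(T))$. For compositions $\alpha,\beta$ of $n$, $A_{\alpha,\beta}$ is the set of pairs $(S,T)$ where $S$ is an immaculate tableau of shape $\alpha$, $T$ is a THC of shape $\beta$, and the content of $S$ equals the weak composition $\Delta(T)$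 (i.e. for each $i$ the number of entries $i$ in $S$ is $\Delta_i(T)$, and $S$ has no entries larger than $\ell(\beta)$). -}

module Defs where

open import Data.Nat using (ℕ; zero; suc; _+_; _≤_; _<_; _≡ᵇ_)
open import Data.Bool using (if_then_else_)
open import Data.Fin using (Fin; toℕ)
import Data.Fin as F
open import Data.Fin.Permutation using (Permutation′; _⟨$⟩ʳ_)
open import Data.Integer using (ℤ; +_; _-_)
open import Data.Product using (Σ; _×_; _,_; proj₁; proj₂)
open import Relation.Binary.PropositionalEquality using (_≡_)

sumFin : ∀ {m} → (Fin m → ℕ) → ℕ
sumFin {zero}  f = 0
sumFin {suc m} f = f F.zero + sumFin (λ i → f (F.suc i))

record Composition (n : ℕ) : Set where
  field
    len      : ℕ
    part     : Fin len → ℕ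
    positive : ∀ i → 1 ≤ part i
    sums     : sumFin part ≡ n
open Composition public

-- A filling of the diagram of α: row i (top = index 0) has cells j : Fin (α i)
-- (column j = 0 is the leftmost / first column).
Filling : ∀ {ℓ} → (Fin ℓ → ℕ) → Set
Filling {ℓ} α = (i : Fin ℓ) → Fin (α i) → ℕ

record IsImmaculate {ℓ} (α : Fin ℓ → ℕ) (S : Filling α) : Set where
  field
    entries-pos : ∀ i j → 1 ≤ S i j
    rows-weak   : ∀ i (j k : Fin (α i)) → toℕ k ≡ suc (toℕ j) → S i j ≤ S i k
    col-strict  : ∀ (i i' : Fin ℓ) (j : Fin (α i)) (j' : Fin (α i')) →
                  toℕ j ≡ 0 → toℕ j' ≡ 0 → toℕ i' ≡ suc (toℕ i) → S i j < S i' j'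

record ImmaculateTableau {n} (α : Composition n) : Set where
  field
    fill      : Filling (part α)
    immaculate : IsImmaculate (part α) fill
open ImmaculateTableau public

count : ∀ {ℓ} {α : Fin ℓ → ℕ} → Filling α → ℕ → ℕ
count S k = sumFin (λ i → sumFin (λ j → if S i j ≡ᵇ k then 1 else 0))

-- Tunnel hook coverings of shape β are identified with their permutation
-- perm(T) ∈ S_ℓ (perm is a bijection from THCs of shape β onto S_ℓ).
record THC {n} (β : Composition n) : Set where
  field
    perm : Permutation′ (len β)
open THC public

-- Δ_i(T) = β_i + σ_i − i (1-indexed; the shift cancels so 0-indexed is identical)
Δ : ∀ {n} {β : Composition n} → THC β → Fin (len β) → ℤ
Δ {β = β} T i = + (part β i + toℕ (perm T ⟨$⟩ʳ i)) - + toℕ i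

-- content of S equals the weak composition Δ(T): entry k+1 occurs Δ_k(T) times
-- for every k < ℓ(β), and no entry exceeds ℓ(β).
ContentEq : ∀ {n} {α β : Composition n} → ImmaculateTableau α → THC β → Set
ContentEq {β = β} S T =
  (∀ (k : Fin (len β)) → + count (fill S) (suc (toℕ k)) ≡ Δ T k)
  × (∀ i j → fill S i j ≤ len β)

A : ∀ {n} → Composition n → Composition n → Set
A α β = Σ (ImmaculateTableau α × THC β) λ p → ContentEq (proj₁ p) (proj₂ p)

SameA : ∀ {n} {α β : Composition n} → A α β → A α β → Set
SameA ((S , T) , _) ((S' , T') , _) =
  (∀ i j → fill S i j ≡ fill S' i j) × (∀ i → perm T ⟨$⟩ʳ i ≡ perm T' ⟨$⟩ʳ i)

-- Every entry of row i (counted from 0) of an immaculate tableau is at least i + 1: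
-- the first column strictly increases from an entry ≥ 1 and rows weakly increase.
-- Hence, by strong induction on k, once rows 0, …, k − 1 are constant with entries
-- 1, …, k and σ fixes 0, …, k − 1, the entry k + 1 can only occur in row k, at most
-- α_k times, while injectivity forces σ k ≥ k, so Δ_k = α_k + σ k − k ≥ α_k.  The
-- content equation therefore makes row k constant equal to k + 1 and σ k = k.
-- Conversely, the tableau with rows constant 1, 2, …, ℓ and the identity permutation
-- satisfy it.
{-# OPTIONS --safe #-}
module Submission where

open import Defs
open import Data.Bool using (true; false; if_then_else_; T)
open import Data.Fin using (Fin; toℕ; fromℕ<; inject₁; _<_; _≤_)
import Data.Fin as F
open import Data.Fin.Induction using (<-wellFounded; <-weakInduction)
open import Data.Fin.Permutation using (Permutation′; _⟨$⟩ʳ_; id)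
import Data.Fin.Properties as Finₚ
open Finₚ using (toℕ-injective; toℕ<n; toℕ-fromℕ<; toℕ-inject₁)
open import Data.Integer as ℤ using (+_)
import Data.Integer.Properties as ℤₚ
open ℤₚ using ([+m]-[+n]≡m⊖n; ⊖-≥)
open import Data.Nat as ℕ using (ℕ; zero; suc; _+_; _*_; _∸_; _≡ᵇ_; z≤n; s≤s)
open import Data.Nat.Properties
open import Data.Product using (Σ; _×_; _,_; proj₁; proj₂)
open import Data.Unit using (tt)
open import Function.Base using (_∘_)
open import Function.Bundles using (Injection)
open import Function.Properties.Inverse using (↔⇒↣)
open import Induction.WellFounded using (module All)
open import Level using (0ℓ)
open import Relation.Binary.Definitions using (tri<; tri≈; tri>)
open import Relation.Binary.PropositionalEquality
  using (_≡_; _≢_; refl; sym; trans; cong; cong₂; subst; module ≡-Reasoning)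
open import Relation.Nullary using (contradiction)
open import Relation.Unary using (Pred)

indicator : ℕ → ℕ → ℕ
indicator x k = if x ≡ᵇ k then 1 else 0

indicator≤1 : ∀ x k → indicator x k ℕ.≤ 1
indicator≤1 x k with x ≡ᵇ k
... | true  = ≤-refl
... | false = z≤n

indicator-≢ : ∀ {x k} → x ≢ k → indicator x k ≡ 0
indicator-≢ {x} {k} x≢k with x ≡ᵇ k in eq
... | true  = contradiction (≡ᵇ⇒≡ x k (subst T (sym eq) tt)) x≢k
... | false = refl

indicator≡1⇒≡ : ∀ {x k} → indicator x k ≡ 1 → x ≡ k
indicator≡1⇒≡ {x} {k} _ with x ≡ᵇ k in eq
indicator≡1⇒≡ {x} {k} _  | true = ≡ᵇ⇒≡ x k (subst T (sym eq) tt)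
indicator≡1⇒≡ {x} {k} () | false

indicator-refl : ∀ x → indicator x x ≡ 1
indicator-refl zero    = refl
indicator-refl (suc x) = indicator-refl x

sumFin-cong : ∀ {m} {f g : Fin m → ℕ} → (∀ i → f i ≡ g i) → sumFin f ≡ sumFin g
sumFin-cong {zero}  f≡g = refl
sumFin-cong {suc m} f≡g = cong₂ _+_ (f≡g F.zero) (sumFin-cong (λ i → f≡g (F.suc i)))

sumFin-const : ∀ m c → sumFin {m} (λ _ → c) ≡ m * c
sumFin-const zero    c = refl
sumFin-const (suc m) c = cong (_+_ c) (sumFin-const m c)

sumFin-ones : ∀ m → sumFin {m} (λ _ → 1) ≡ m
sumFin-ones m = trans (sumFin-const m 1) (*-identityʳ m)

sumFin-zero : ∀ {m} {f : Fin m → ℕ} → (∀ i → f i ≡ 0) → sumFin f ≡ 0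
sumFin-zero {m} f≡0 = trans (sumFin-cong f≡0) (trans (sumFin-const m 0) (*-zeroʳ m))

sumFin-single : ∀ {m} {f : Fin m → ℕ} k → (∀ i → i ≢ k → f i ≡ 0) → sumFin f ≡ f k
sumFin-single {suc m} {f} F.zero    vanish =
  trans (cong (_+_ (f F.zero)) (sumFin-zero (λ i → vanish (F.suc i) (λ ())))) (+-identityʳ _)
sumFin-single {suc m} {f} (F.suc k) vanish =
  trans (cong (λ x → x + sumFin (λ i → f (F.suc i))) (vanish F.zero (λ ())))
        (sumFin-single k (λ i i≢k → vanish (F.suc i) (λ e → i≢k (Finₚ.suc-injective e))))

sumFin-mono-≤ : ∀ {m} {f g : Fin m → ℕ} → (∀ i → f i ℕ.≤ g i) → sumFin f ℕ.≤ sumFin g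
sumFin-mono-≤ {zero}  f≤g = z≤n
sumFin-mono-≤ {suc m} f≤g = +-mono-≤ (f≤g F.zero) (sumFin-mono-≤ (λ i → f≤g (F.suc i)))

+-mono-≤-rigid : ∀ {a b c d} → a ℕ.≤ c → b ℕ.≤ d → a + b ≡ c + d → a ≡ c × b ≡ d
+-mono-≤-rigid {a} {b} {c} {d} a≤c b≤d a+b≡c+d =
  a≡c , +-cancelˡ-≡ c b d (subst (λ x → x + b ≡ c + d) a≡c a+b≡c+d)
  where
  a≡c : a ≡ c
  a≡c = ≤∧≮⇒≡ a≤c (λ a<c → <-irrefl a+b≡c+d (+-mono-<-≤ a<c b≤d))

sumFin-mono-≤-rigid : ∀ {m} {f g : Fin m → ℕ} → (∀ i → f i ℕ.≤ g i) →
                      sumFin f ≡ sumFin g → ∀ i → f i ≡ g i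
sumFin-mono-≤-rigid {suc m} f≤g Σf≡Σg F.zero    =
  proj₁ (+-mono-≤-rigid (f≤g F.zero) (sumFin-mono-≤ (λ i → f≤g (F.suc i))) Σf≡Σg)
sumFin-mono-≤-rigid {suc m} f≤g Σf≡Σg (F.suc i) =
  sumFin-mono-≤-rigid (λ i → f≤g (F.suc i))
    (proj₂ (+-mono-≤-rigid (f≤g F.zero) (sumFin-mono-≤ (λ i → f≤g (F.suc i))) Σf≡Σg)) i

rowCount : ∀ {ℓ} {α : Fin ℓ → ℕ} → Filling α → Fin ℓ → ℕ → ℕ
rowCount S i k = sumFin (λ j → indicator (S i j) k)

module _ {ℓ} {α : Fin ℓ → ℕ} (S : Filling α) where

  count≡rowCount : ∀ i k → (∀ i′ → i′ ≢ i → ∀ j → S i′ j ≢ k) → count S k ≡ rowCount S i k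
  count≡rowCount i k avoid =
    sumFin-single i (λ i′ i′≢i → sumFin-zero (λ j → indicator-≢ (avoid i′ i′≢i j)))

  rowCount≤rowLength : ∀ i k → rowCount S i k ℕ.≤ α i
  rowCount≤rowLength i k =
    subst (rowCount S i k ℕ.≤_) (sumFin-ones (α i)) (sumFin-mono-≤ (λ j → indicator≤1 (S i j) k))

  rowCount≡rowLength⇒constant : ∀ i k → rowCount S i k ≡ α i → ∀ j → S i j ≡ k
  rowCount≡rowLength⇒constant i k full j = indicator≡1⇒≡
    (sumFin-mono-≤-rigid (λ j → indicator≤1 (S i j) k) (trans full (sym (sumFin-ones (α i)))) j)

  constant⇒rowCount≡rowLength : ∀ i k → (∀ j → S i j ≡ k) → rowCount S i k ≡ α i
  constant⇒rowCount≡rowLength i k constant =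
    trans (sumFin-cong (λ j → trans (cong (λ x → indicator x k) (constant j)) (indicator-refl k)))
          (sumFin-ones (α i))

Fin-stepInduction : ∀ {m p} (P : Pred (Fin m) p) → (∀ j → toℕ j ≡ 0 → P j) →
                    (∀ j k → toℕ k ≡ suc (toℕ j) → P j → P k) → ∀ j → P j
Fin-stepInduction {zero}  P base step ()
Fin-stepInduction {suc m} P base step = <-weakInduction P (base F.zero refl)
  (λ j → step (inject₁ j) (F.suc j) (cong suc (sym (toℕ-inject₁ j))))

stepwise-mono⇒first≤ : ∀ {m} (f : Fin m → ℕ) → (∀ j k → toℕ k ≡ suc (toℕ j) → f j ℕ.≤ f k) →
                       ∀ j₀ → toℕ j₀ ≡ 0 → ∀ j → f j₀ ℕ.≤ f j
stepwise-mono⇒first≤ f mono j₀ j₀≡0 = Fin-stepInduction (λ j → f j₀ ℕ.≤ f j)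
  (λ j j≡0 → ≤-reflexive (cong f (toℕ-injective (trans j₀≡0 (sym j≡0)))))
  (λ j k k≡1+j f₀≤fj → ≤-trans f₀≤fj (mono j k k≡1+j))

module _ {ℓ} {α : Fin ℓ → ℕ} (α-pos : ∀ i → 1 ℕ.≤ α i)
  {S : Filling α} (imm : IsImmaculate α S) where
  open IsImmaculate imm

  private
    first-cell : ∀ i → Fin (α i)
    first-cell i = fromℕ< (α-pos i)

  row-index<first-column : ∀ i j → toℕ j ≡ 0 → toℕ i ℕ.< S i j
  row-index<first-column = Fin-stepInduction (λ i → ∀ j → toℕ j ≡ 0 → toℕ i ℕ.< S i j)
    (λ i i≡0 j j≡0 → subst (ℕ._< S i j) (sym i≡0) (entries-pos i j))
    (λ i i′ i′≡1+i below j′ j′≡0 → subst (ℕ._< S i′ j′) (sym i′≡1+i)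
      (≤-trans (s≤s (below (first-cell i) (toℕ-fromℕ< _)))
               (col-strict i i′ (first-cell i) j′ (toℕ-fromℕ< _) j′≡0 i′≡1+i)))

  row-index<entry : ∀ i j → toℕ i ℕ.< S i j
  row-index<entry i j = <-≤-trans (row-index<first-column i (first-cell i) (toℕ-fromℕ< _))
    (stepwise-mono⇒first≤ (S i) (rows-weak i) (first-cell i) (toℕ-fromℕ< _) j)

fixes-below⇒≤ : ∀ {ℓ} (σ : Permutation′ ℓ) k → (∀ {m} → m < k → σ ⟨$⟩ʳ m ≡ m) → k ≤ σ ⟨$⟩ʳ k
fixes-below⇒≤ σ k fixes = ≮⇒≥ λ σk<k →
  Finₚ.<-irrefl (Injection.injective (↔⇒↣ σ) (fixes σk<k)) σk<k

+[m+n]-+o≡+[m+[n∸o]] : ∀ m {n o} → o ℕ.≤ n → + (m + n) ℤ.- + o ≡ + (m + (n ∸ o))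
+[m+n]-+o≡+[m+[n∸o]] m {n} {o} o≤n = begin
  + (m + n) ℤ.- + o   ≡⟨ [+m]-[+n]≡m⊖n (m + n) o ⟩
  (m + n) ℤ.⊖ o       ≡⟨ ⊖-≥ (≤-trans o≤n (m≤n+m n m)) ⟩
  + (m + n ∸ o)       ≡⟨ cong +_ (+-∸-assoc m o≤n) ⟩
  + (m + (n ∸ o))     ∎
  where open ≡-Reasoning

+[m+n]-+n≡+m : ∀ m n → + (m + n) ℤ.- + n ≡ + m
+[m+n]-+n≡+m m n = begin
  + (m + n) ℤ.- + n   ≡⟨ +[m+n]-+o≡+[m+[n∸o]] m (≤-refl {n}) ⟩
  + (m + (n ∸ n))     ≡⟨ cong (λ x → + (m + x)) (n∸n≡0 n) ⟩
  + (m + 0)           ≡⟨ cong +_ (+-identityʳ m) ⟩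
  + m                 ∎
  where open ≡-Reasoning

m+n≤m⇒n≡0 : ∀ m {n} → m + n ℕ.≤ m → n ≡ 0
m+n≤m⇒n≡0 m {n} m+n≤m =
  n≤0⇒n≡0 (+-cancelˡ-≤ m n 0 (subst (m + n ℕ.≤_) (sym (+-identityʳ m)) m+n≤m))

module Rigidity {ℓ} {α : Fin ℓ → ℕ} (α-pos : ∀ i → 1 ℕ.≤ α i)
  {S : Filling α} (imm : IsImmaculate α S) (σ : Permutation′ ℓ)
  (content : ∀ k → + count S (suc (toℕ k)) ≡ + (α k + toℕ (σ ⟨$⟩ʳ k)) ℤ.- + toℕ k) where

  Settled : Fin ℓ → Set
  Settled k = σ ⟨$⟩ʳ k ≡ k × (∀ j → S k j ≡ suc (toℕ k))

  settle : ∀ k → (∀ {m} → m < k → Settled m) → Settled k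
  settle k below = toℕ-injective σk≡k , rowCount≡rowLength⇒constant S k K rowCount≡αk
    where
    K = suc (toℕ k)

    avoid : ∀ i → i ≢ k → ∀ j → S i j ≢ K
    avoid i i≢k j Sij≡K with Finₚ.<-cmp i k
    ... | tri< i<k _ _ =
      i≢k (toℕ-injective (suc-injective (trans (sym (proj₂ (below i<k) j)) Sij≡K)))
    ... | tri≈ _ i≡k _ = i≢k i≡k
    ... | tri> _ _ k<i =
      <⇒≱ k<i (ℕ.s≤s⁻¹ (subst (toℕ i ℕ.<_) Sij≡K (row-index<entry α-pos imm i j)))

    k≤σk : k ≤ σ ⟨$⟩ʳ k
    k≤σk = fixes-below⇒≤ σ k (λ m<k → proj₁ (below m<k))

    gap : ℕ
    gap = toℕ (σ ⟨$⟩ʳ k) ∸ toℕ k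

    rowCount≡αk+gap : rowCount S k K ≡ α k + gap
    rowCount≡αk+gap = ℤₚ.+-injective (begin
      + rowCount S k K                       ≡⟨ cong +_ (sym (count≡rowCount S k K avoid)) ⟩
      + count S K                            ≡⟨ content k ⟩
      + (α k + toℕ (σ ⟨$⟩ʳ k)) ℤ.- + toℕ k  ≡⟨ +[m+n]-+o≡+[m+[n∸o]] (α k) k≤σk ⟩
      + (α k + gap)                          ∎)
      where open ≡-Reasoning

    gap≡0 : gap ≡ 0
    gap≡0 = m+n≤m⇒n≡0 (α k) (subst (ℕ._≤ α k) rowCount≡αk+gap (rowCount≤rowLength S k K))

    rowCount≡αk : rowCount S k K ≡ α k
    rowCount≡αk = trans rowCount≡αk+gap (trans (cong (_+_ (α k)) gap≡0) (+-identityʳ (α k)))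

    σk≡k : toℕ (σ ⟨$⟩ʳ k) ≡ toℕ k
    σk≡k = ≤-antisym (m∸n≡0⇒m≤n gap≡0) k≤σk

  settled : ∀ k → Settled k
  settled = All.wfRec <-wellFounded 0ℓ Settled settle

superstandard : ∀ {n} (α : Composition n) → ImmaculateTableau α
superstandard α = record
  { fill       = λ i _ → suc (toℕ i)
  ; immaculate = record
    { entries-pos = λ _ _ → s≤s z≤n
    ; rows-weak   = λ _ _ _ _ → ≤-refl
    ; col-strict  = λ _ _ _ _ _ _ i′≡1+i → ≤-reflexive (cong suc (sym i′≡1+i))
    }
  }

identityTHC : ∀ {n} (β : Composition n) → THC β
identityTHC β = record { perm = id }

superstandard-content : ∀ {n} (α : Composition n) → ContentEq (superstandard α) (identityTHC α)
superstandard-content α = content , λ i _ → toℕ<n i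
  where
  S = fill (superstandard α)

  content : ∀ k → + count S (suc (toℕ k)) ≡ Δ (identityTHC α) k
  content k = begin
    + count S (suc (toℕ k))            ≡⟨ cong +_ (count≡rowCount S k _ avoid) ⟩
    + rowCount S k (suc (toℕ k))       ≡⟨ cong +_ (constant⇒rowCount≡rowLength S k _ (λ _ → refl)) ⟩
    + part α k                         ≡⟨ sym (+[m+n]-+n≡+m (part α k) (toℕ k)) ⟩
    + (part α k + toℕ k) ℤ.- + toℕ k   ∎
    where
    open ≡-Reasoning
    avoid : ∀ i → i ≢ k → ∀ j → S i j ≢ suc (toℕ k)
    avoid i i≢k j = i≢k ∘ toℕ-injective ∘ suc-injective

lemma3p1 : ∀ (n : ℕ) (α : Composition n) →
    Σ (A α α) λ p →
      (∀ (q : A α α) → SameA q p)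
      × (∀ i → perm (proj₂ (proj₁ p)) ⟨$⟩ʳ i ≡ i)
lemma3p1 n α = ((superstandard α , identityTHC α) , superstandard-content α) , unique , λ _ → refl
  where
  unique : ∀ q → SameA q ((superstandard α , identityTHC α) , superstandard-content α)
  unique ((S , T) , content , _) = (λ i → proj₂ (settled i)) , (λ i → proj₁ (settled i))
    where open Rigidity (positive α) (immaculate S) (perm T) content
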